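{- Let $G$ be a finite $2$PCI-group and $H$ a characteristic subgroup of $G$. Then the quotient group $G/H$ is a $2$PCI-group.
   Context: For a finite group $X$ and $S\subseteq X$, $\mathrm{BCay}(X,S)$ is the bipartite graph with vertex set $X_1\cup X_2$, $X_i=\{x_i:x\in X\}$ two disjoint copies of $X$, and edges $\{x_1,(sx)_2\}$, $s\in S$, $x\in X$ (a $2$-PCayley graph of $X$). $R(g):x_i\mapsto(xg)_i$, $R(X)=\{R(g)\}$, $N$ the normalizer of $R(X)$ in the symmetric group on $X_1\cup X_2$. A $2$-PCayley graph $\Gamma$ of $X$ is $2$PCI if for every $2$-PCayley graph $\Sigma$ of $X$ such that some isomorphism $\Gamma\to\Sigma$ maps $\{X_1,X_2\}$ to itself, there is $n\in N$ with $\Gamma^n=\Sigma$; $X$ is a $2$PCI-group if all its $2$-PCayley graphs are $2$PCI. -}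

module Defs where

open import Level using (0ℓ)
open import Data.Nat using (ℕ)
open import Data.Fin using (Fin)
open import Data.Bool using (Bool; true; false)
open import Data.Sum using (_⊎_; inj₁; inj₂)
open import Data.Product using (Σ; ∃; ∃-syntax; _×_; _,_)
open import Data.Empty using (⊥)
open import Data.Unit using (⊤)
open import Relation.Binary.PropositionalEquality using (_≡_)
import Algebra.Structures as AS
open import Function.Bundles using (_↔_; _⇔_; Inverse)

record FinGroup : Set₁ where
  infixl 7 _∙_
  infix 8 _⁻¹
  field
    Carrier : Set
    _∙_     : Carrier → Carrier → Carrier
    ε       : Carrier
    _⁻¹     : Carrier → Carrier
    isGroup : AS.IsGroup {A = Carrier} _≡_ _∙_ ε _⁻¹
    size    : ℕ
    enum    : Fin size ↔ Carrier

Elt : FinGroup → Set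
Elt = FinGroup.Carrier

SubsetOf : Set → Set
SubsetOf A = A → Bool

Graph : Set → Set₁
Graph V = V → V → Set

module _ (X : FinGroup) where
  open FinGroup X

  -- Vertex set X₁ ∪ X₂ : inj₁ x = x₁ , inj₂ x = x₂
  Vertex : Set
  Vertex = Carrier ⊎ Carrier

  -- BCay(X,S): edges {x₁,(sx)₂} for s ∈ S, x ∈ X,
  -- i.e. x₁ ~ y₂ iff y x⁻¹ ∈ S.
  BCay : SubsetOf Carrier → Graph Vertex
  BCay S (inj₁ x) (inj₂ y) = S (y ∙ x ⁻¹) ≡ true
  BCay S (inj₂ y) (inj₁ x) = S (y ∙ x ⁻¹) ≡ true
  BCay S (inj₁ _) (inj₁ _) = ⊥
  BCay S (inj₂ _) (inj₂ _) = ⊥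

  R : Carrier → Vertex → Vertex
  R g (inj₁ x) = inj₁ (x ∙ g)
  R g (inj₂ x) = inj₂ (x ∙ g)

  Perm : Set
  Perm = Vertex ↔ Vertex

  -- n lies in the normalizer N of R(X) in Sym(X₁ ∪ X₂):  n R(X) n⁻¹ = R(X)
  InNormalizer : Perm → Set
  InNormalizer n =
    (∀ g → ∃[ h ] (∀ v → Inverse.to n (R g (Inverse.from n v)) ≡ R h v)) ×
    (∀ h → ∃[ g ] (∀ v → Inverse.to n (R g (Inverse.from n v)) ≡ R h v))

  IsIsomorphism : Perm → Graph Vertex → Graph Vertex → Set
  IsIsomorphism f Γ Σ′ = ∀ u v → Γ u v ⇔ Σ′ (Inverse.to f u) (Inverse.to f v)

  -- Γ^n = Σ : the image of Γ under n (edges {u^n, v^n}) equals Σ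
  ImageEquals : Perm → Graph Vertex → Graph Vertex → Set
  ImageEquals n Γ Σ′ = ∀ a b → Γ (Inverse.from n a) (Inverse.from n b) ⇔ Σ′ a b

  InX₁ : Vertex → Set
  InX₁ (inj₁ _) = ⊤
  InX₁ (inj₂ _) = ⊥

  InX₂ : Vertex → Set
  InX₂ (inj₁ _) = ⊥
  InX₂ (inj₂ _) = ⊤

  PreservesBipartition : Perm → Set
  PreservesBipartition f =
    ((∀ x → InX₁ (Inverse.to f (inj₁ x))) × (∀ x → InX₂ (Inverse.to f (inj₂ x)))) ⊎
    ((∀ x → InX₂ (Inverse.to f (inj₁ x))) × (∀ x → InX₁ (Inverse.to f (inj₂ x))))

  Is2PCI : SubsetOf Carrier → Set
  Is2PCI S = ∀ (T : SubsetOf Carrier) (f : Perm) →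
    IsIsomorphism f (BCay S) (BCay T) → PreservesBipartition f →
    ∃[ n ] (InNormalizer n × ImageEquals n (BCay S) (BCay T))

  Is2PCIGroup : Set
  Is2PCIGroup = ∀ (S : SubsetOf Carrier) → Is2PCI S

  IsSubgroup : SubsetOf Carrier → Set
  IsSubgroup H =
    (H ε ≡ true) ×
    (∀ x y → H x ≡ true → H y ≡ true → H (x ∙ y) ≡ true) ×
    (∀ x → H x ≡ true → H (x ⁻¹) ≡ true)

  IsAutomorphism : (Carrier ↔ Carrier) → Set
  IsAutomorphism α = ∀ x y → Inverse.to α (x ∙ y) ≡ Inverse.to α x ∙ Inverse.to α y

  IsCharacteristic : SubsetOf Carrier → Set
  IsCharacteristic H =
    ∀ (α : Carrier ↔ Carrier) → IsAutomorphism α → ∀ x → H (Inverse.to α x) ≡ H x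

module _ (G Q : FinGroup) where
  private
    module G = FinGroup G
    module Q = FinGroup Q

  IsHomomorphism : (G.Carrier → Q.Carrier) → Set
  IsHomomorphism π = ∀ x y → π (x G.∙ y) ≡ π x Q.∙ π y

  IsSurjective : (G.Carrier → Q.Carrier) → Set
  IsSurjective π = ∀ q → ∃[ x ] (π x ≡ q)

  KernelIs : (G.Carrier → Q.Carrier) → SubsetOf G.Carrier → Set
  KernelIs π H = ∀ x → (π x ≡ Q.ε) ⇔ (H x ≡ true)

  IsQuotientBy : SubsetOf G.Carrier → (G.Carrier → Q.Carrier) → Set
  IsQuotientBy H π = IsHomomorphism π × IsSurjective π × KernelIs π H

-- Let π : G → Q = G/H. Every vertex w of BCay(G, S) is w = R(k) σ(π w) for a fixed
-- section σ of π and a unique "offset" k ∈ H. A bipartition-preserving isomorphism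
-- f : BCay(Q, A) → BCay(Q, B) lifts to BCay(G, A ∘ π) → BCay(G, B ∘ π) by acting as f
-- on π w and keeping the offset, so the 2PCI property of G yields n in the
-- normaliser of R(G) with BCay(G, A ∘ π)ⁿ = BCay(G, B ∘ π). Conjugation by n induces
-- an automorphism of G; since H is characteristic, n permutes the cosets of H and so
-- descends to an element of the normaliser of R(Q) mapping BCay(Q, A) onto BCay(Q, B).
module Submission where

open import Level using (0ℓ)
open import Algebra.Bundles using (Group)
import Algebra.Properties.Group as GroupProperties
open import Data.Bool using (true)
open import Data.Product using (_,_; proj₁; proj₂)
open import Data.Sum as Sum using (inj₁; inj₂)
open import Data.Sum.Properties using (inj₁-injective; inj₂-injective)
open import Data.Unit using (tt)
open import Function.Base using (_∘_)
open import Function.Bundles using (_↔_; _⇔_; Inverse; Equivalence; mk⇔; mk↔ₛ′)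
open import Function.Properties.Equivalence using (⇔-setoid)
open import Relation.Binary.Bundles using (Setoid)
open import Relation.Binary.PropositionalEquality
open import Defs

≡⇒⇔ : ∀ {A B : Set} → A ≡ B → A ⇔ B
≡⇒⇔ = Setoid.reflexive (⇔-setoid 0ℓ)

group : FinGroup → Group 0ℓ 0ℓ
group X = record { isGroup = FinGroup.isGroup X }

module _ (G Q : FinGroup) {π : Elt G → Elt Q} (hom : IsHomomorphism G Q π) where
  private
    module G = FinGroup G
    module Q = FinGroup Q
    open GroupProperties (group Q) using (identityˡ-unique; inverseˡ-unique)

  homomorphism-ε : π G.ε ≡ Q.ε
  homomorphism-ε = identityˡ-unique (π G.ε) (π G.ε)
    (trans (sym (hom G.ε G.ε)) (cong π (Group.identityˡ (group G) G.ε)))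

  homomorphism-⁻¹ : ∀ x → π (x G.⁻¹) ≡ π x Q.⁻¹
  homomorphism-⁻¹ x = inverseˡ-unique (π (x G.⁻¹)) (π x)
    (trans (sym (hom (x G.⁻¹) x)) (trans (cong π (Group.inverseˡ (group G) x)) homomorphism-ε))

  homomorphism-∙⁻¹ : ∀ x y → π (x G.∙ y G.⁻¹) ≡ π x Q.∙ π y Q.⁻¹
  homomorphism-∙⁻¹ x y = trans (hom x (y G.⁻¹)) (cong (π x Q.∙_) (homomorphism-⁻¹ y))

module RightRegular (X : FinGroup) where
  open FinGroup X
  open Group (group X) using (assoc; identityʳ)
  open GroupProperties (group X) using (∙-cancelˡ)

  R-ε : ∀ w → R X ε w ≡ w
  R-ε (inj₁ x) = cong inj₁ (identityʳ x)
  R-ε (inj₂ x) = cong inj₂ (identityʳ x)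

  R-∙ : ∀ g h w → R X (g ∙ h) w ≡ R X h (R X g w)
  R-∙ g h (inj₁ x) = cong inj₁ (sym (assoc x g h))
  R-∙ g h (inj₂ x) = cong inj₂ (sym (assoc x g h))

  R-injective : ∀ {g h} w → R X g w ≡ R X h w → g ≡ h
  R-injective (inj₁ x) p = ∙-cancelˡ x _ _ (inj₁-injective p)
  R-injective (inj₂ x) p = ∙-cancelˡ x _ _ (inj₂-injective p)

module NormalizerAutomorphism (X : FinGroup) (n : Perm X) (n∈N : InNormalizer X n) where
  open FinGroup X
  open RightRegular X
  open Inverse n using (to; from; strictlyInverseˡ; strictlyInverseʳ)

  private
    v : Vertex X
    v = inj₁ ε

  conj conj⁻¹ : Carrier → Carrier
  conj g = proj₁ (proj₁ n∈N g)
  conj⁻¹ h = proj₁ (proj₂ n∈N h)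

  conj-R : ∀ g w → to (R X g w) ≡ R X (conj g) (to w)
  conj-R g w = trans (cong (to ∘ R X g) (sym (strictlyInverseʳ w))) (proj₂ (proj₁ n∈N g) (to w))

  conj⁻¹-R : ∀ h w → from (R X h w) ≡ R X (conj⁻¹ h) (from w)
  conj⁻¹-R h w = trans (cong from (sym (proj₂ (proj₂ n∈N h) w))) (strictlyInverseʳ _)

  conj-conj⁻¹ : ∀ h → conj (conj⁻¹ h) ≡ h
  conj-conj⁻¹ h = R-injective (to (from v)) (begin
    R X (conj (conj⁻¹ h)) (to (from v)) ≡⟨ conj-R (conj⁻¹ h) (from v) ⟨
    to (R X (conj⁻¹ h) (from v))        ≡⟨ proj₂ (proj₂ n∈N h) v ⟩
    R X h v                             ≡⟨ cong (R X h) (strictlyInverseˡ v) ⟨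
    R X h (to (from v))                 ∎)
    where open ≡-Reasoning

  conj⁻¹-conj : ∀ g → conj⁻¹ (conj g) ≡ g
  conj⁻¹-conj g = R-injective (from (to v)) (begin
    R X (conj⁻¹ (conj g)) (from (to v)) ≡⟨ conj⁻¹-R (conj g) (to v) ⟨
    from (R X (conj g) (to v))          ≡⟨ cong from (conj-R g v) ⟨
    from (to (R X g v))                 ≡⟨ strictlyInverseʳ _ ⟩
    R X g v                             ≡⟨ cong (R X g) (strictlyInverseʳ v) ⟨
    R X g (from (to v))                 ∎)
    where open ≡-Reasoning

  conj-homomorphism : ∀ g h → conj (g ∙ h) ≡ conj g ∙ conj h
  conj-homomorphism g h = R-injective (to v) (begin
    R X (conj (g ∙ h)) (to v)            ≡⟨ conj-R (g ∙ h) v ⟨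
    to (R X (g ∙ h) v)                   ≡⟨ cong to (R-∙ g h v) ⟩
    to (R X h (R X g v))                 ≡⟨ conj-R h (R X g v) ⟩
    R X (conj h) (to (R X g v))          ≡⟨ cong (R X (conj h)) (conj-R g v) ⟩
    R X (conj h) (R X (conj g) (to v))   ≡⟨ R-∙ (conj g) (conj h) (to v) ⟨
    R X (conj g ∙ conj h) (to v)         ∎)
    where open ≡-Reasoning

  conjugation : Carrier ↔ Carrier
  conjugation = mk↔ₛ′ conj conj⁻¹ conj-conj⁻¹ conj⁻¹-conj

  conjugation-isAutomorphism : IsAutomorphism X conjugation
  conjugation-isAutomorphism = conj-homomorphism

KernelIsCharacteristic : (G Q : FinGroup) → (Elt G → Elt Q) → Set
KernelIsCharacteristic G Q π =
  ∀ α → IsAutomorphism G α → ∀ x → π (Inverse.to α x) ≡ FinGroup.ε Q ⇔ π x ≡ FinGroup.ε Q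

module QuotientMap (G Q : FinGroup) (π : Elt G → Elt Q)
  (hom : IsHomomorphism G Q π) (sur : IsSurjective G Q π) where
  private
    module G = FinGroup G
    module Q = FinGroup Q
  open G using (_∙_; _⁻¹)
  open GroupProperties (group G) using (\\-leftDividesˡ; \\-leftDividesʳ)
  open RightRegular Q using (R-ε)

  πᵛ : Vertex G → Vertex Q
  πᵛ = Sum.map π π

  section : Elt Q → Elt G
  section q = proj₁ (sur q)

  σᵛ : Vertex Q → Vertex G
  σᵛ = Sum.map section section

  π-section : ∀ q → π (section q) ≡ q
  π-section q = proj₂ (sur q)

  πᵛ-σᵛ : ∀ v → πᵛ (σᵛ v) ≡ v
  πᵛ-σᵛ (inj₁ q) = cong inj₁ (π-section q)
  πᵛ-σᵛ (inj₂ q) = cong inj₂ (π-section q)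

  πᵛ-R : ∀ k w → πᵛ (R G k w) ≡ R Q (π k) (πᵛ w)
  πᵛ-R k (inj₁ x) = cong inj₁ (hom x k)
  πᵛ-R k (inj₂ x) = cong inj₂ (hom x k)

  πᵛ-R-kernel : ∀ {k} w → π k ≡ Q.ε → πᵛ (R G k w) ≡ πᵛ w
  πᵛ-R-kernel {k} w πk≡ε =
    trans (πᵛ-R k w) (trans (cong (λ q → R Q q (πᵛ w)) πk≡ε) (R-ε (πᵛ w)))

  BCay-pullback : ∀ A u v → BCay G (A ∘ π) u v ⇔ BCay Q A (πᵛ u) (πᵛ v)
  BCay-pullback A (inj₁ x) (inj₁ y) = mk⇔ (λ ()) (λ ())
  BCay-pullback A (inj₂ x) (inj₂ y) = mk⇔ (λ ()) (λ ())
  BCay-pullback A (inj₁ x) (inj₂ y) = ≡⇒⇔ (cong (λ q → A q ≡ true) (homomorphism-∙⁻¹ G Q hom y x))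
  BCay-pullback A (inj₂ y) (inj₁ x) = ≡⇒⇔ (cong (λ q → A q ≡ true) (homomorphism-∙⁻¹ G Q hom y x))

  offset : Vertex G → Elt G
  offset w = section (π (Sum.reduce w)) ⁻¹ ∙ Sum.reduce w

  offset-decomposes : ∀ w → R G (offset w) (σᵛ (πᵛ w)) ≡ w
  offset-decomposes (inj₁ x) = cong inj₁ (\\-leftDividesˡ _ x)
  offset-decomposes (inj₂ x) = cong inj₂ (\\-leftDividesˡ _ x)

  offset-kernel : ∀ w → π (offset w) ≡ Q.ε
  offset-kernel w = begin
    π (section (π x) ⁻¹ ∙ x)         ≡⟨ hom _ x ⟩
    π (section (π x) ⁻¹) Q.∙ π x     ≡⟨ cong (Q._∙ π x) (homomorphism-⁻¹ G Q hom _) ⟩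
    π (section (π x)) Q.⁻¹ Q.∙ π x   ≡⟨ cong (λ q → q Q.⁻¹ Q.∙ π x) (π-section (π x)) ⟩
    π x Q.⁻¹ Q.∙ π x                 ≡⟨ Group.inverseˡ (group Q) (π x) ⟩
    Q.ε                              ∎
    where
    open ≡-Reasoning
    x = Sum.reduce w

  coset-offset : ∀ {k} q → π k ≡ Q.ε → section (π (section q ∙ k)) ⁻¹ ∙ (section q ∙ k) ≡ k
  coset-offset {k} q πk≡ε =
    trans (cong (λ p → section p ⁻¹ ∙ (section q ∙ k)) π[sq∙k]≡q) (\\-leftDividesʳ (section q) k)
    where
    π[sq∙k]≡q : π (section q ∙ k) ≡ q
    π[sq∙k]≡q = trans (hom (section q) k)
      (trans (cong₂ Q._∙_ (π-section q) πk≡ε) (Group.identityʳ (group Q) q))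

  offset-unique : ∀ {k} v → π k ≡ Q.ε → offset (R G k (σᵛ v)) ≡ k
  offset-unique (inj₁ q) = coset-offset q
  offset-unique (inj₂ q) = coset-offset q

  lift : (Vertex Q → Vertex Q) → Vertex G → Vertex G
  lift f w = R G (offset w) (σᵛ (f (πᵛ w)))

  πᵛ-lift : ∀ f w → πᵛ (lift f w) ≡ f (πᵛ w)
  πᵛ-lift f w = trans (πᵛ-R-kernel (σᵛ (f (πᵛ w))) (offset-kernel w)) (πᵛ-σᵛ _)

  lift-inverse : ∀ f g → (∀ v → g (f v) ≡ v) → ∀ w → lift g (lift f w) ≡ w
  lift-inverse f g g∘f≡id w = begin
    R G (offset (lift f w)) (σᵛ (g (πᵛ (lift f w))))  ≡⟨ cong₂ (λ k v → R G k (σᵛ (g v)))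
                                                           (offset-unique (f (πᵛ w)) (offset-kernel w))
                                                           (πᵛ-lift f w) ⟩
    R G (offset w) (σᵛ (g (f (πᵛ w))))               ≡⟨ cong (R G (offset w) ∘ σᵛ) (g∘f≡id _) ⟩
    R G (offset w) (σᵛ (πᵛ w))                       ≡⟨ offset-decomposes w ⟩
    w                                                ∎
    where open ≡-Reasoning

  liftPerm : Perm Q → Perm G
  liftPerm f = mk↔ₛ′ (lift (Inverse.to f)) (lift (Inverse.from f))
    (lift-inverse (Inverse.from f) (Inverse.to f) (Inverse.strictlyInverseˡ f))
    (lift-inverse (Inverse.to f) (Inverse.from f) (Inverse.strictlyInverseʳ f))

  liftPerm-isomorphism : ∀ {f} A B → IsIsomorphism Q f (BCay Q A) (BCay Q B) →
    IsIsomorphism G (liftPerm f) (BCay G (A ∘ π)) (BCay G (B ∘ π))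
  liftPerm-isomorphism {f} A B f-iso u v = begin
    BCay G (A ∘ π) u v                     ≈⟨ BCay-pullback A u v ⟩
    BCay Q A (πᵛ u) (πᵛ v)                 ≈⟨ f-iso (πᵛ u) (πᵛ v) ⟩
    BCay Q B (t (πᵛ u)) (t (πᵛ v))         ≡⟨ cong₂ (BCay Q B) (πᵛ-lift t u) (πᵛ-lift t v) ⟨
    BCay Q B (πᵛ (lift t u)) (πᵛ (lift t v)) ≈⟨ BCay-pullback B (lift t u) (lift t v) ⟨
    BCay G (B ∘ π) (lift t u) (lift t v)   ∎
    where
    open import Relation.Binary.Reasoning.Setoid (⇔-setoid 0ℓ)
    t = Inverse.to f

  InX₁-πᵛ : ∀ w → InX₁ Q (πᵛ w) → InX₁ G w
  InX₁-πᵛ (inj₁ _) _ = tt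

  InX₂-πᵛ : ∀ w → InX₂ Q (πᵛ w) → InX₂ G w
  InX₂-πᵛ (inj₂ _) _ = tt

  lift-InX₁ : ∀ {f} w → InX₁ Q (f (πᵛ w)) → InX₁ G (lift f w)
  lift-InX₁ {f} w = InX₁-πᵛ (lift f w) ∘ subst (InX₁ Q) (sym (πᵛ-lift f w))

  lift-InX₂ : ∀ {f} w → InX₂ Q (f (πᵛ w)) → InX₂ G (lift f w)
  lift-InX₂ {f} w = InX₂-πᵛ (lift f w) ∘ subst (InX₂ Q) (sym (πᵛ-lift f w))

  liftPerm-preservesBipartition : ∀ {f} → PreservesBipartition Q f → PreservesBipartition G (liftPerm f)
  liftPerm-preservesBipartition {f} (inj₁ (p₁ , p₂)) =
    inj₁ ((λ x → lift-InX₁ {Inverse.to f} (inj₁ x) (p₁ (π x))) ,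
          (λ x → lift-InX₂ {Inverse.to f} (inj₂ x) (p₂ (π x))))
  liftPerm-preservesBipartition {f} (inj₂ (p₁ , p₂)) =
    inj₂ ((λ x → lift-InX₂ {Inverse.to f} (inj₁ x) (p₁ (π x))) ,
          (λ x → lift-InX₁ {Inverse.to f} (inj₂ x) (p₂ (π x))))

  descend : (Vertex G → Vertex G) → Vertex Q → Vertex Q
  descend t v = πᵛ (t (σᵛ v))

  RespectsFibres : (Vertex G → Vertex G) → Set
  RespectsFibres t = ∀ w → πᵛ (t w) ≡ descend t (πᵛ w)

  equivariant⇒respectsFibres : ∀ {t} (φ : Elt G → Elt G) →
    (∀ k → π k ≡ Q.ε → π (φ k) ≡ Q.ε) → (∀ k w → t (R G k w) ≡ R G (φ k) (t w)) →
    RespectsFibres t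
  equivariant⇒respectsFibres {t} φ φ-kernel t-equivariant w = begin
    πᵛ (t w)                                      ≡⟨ cong (πᵛ ∘ t) (offset-decomposes w) ⟨
    πᵛ (t (R G (offset w) (σᵛ (πᵛ w))))           ≡⟨ cong πᵛ (t-equivariant _ _) ⟩
    πᵛ (R G (φ (offset w)) (t (σᵛ (πᵛ w))))
      ≡⟨ πᵛ-R-kernel (t (σᵛ (πᵛ w))) (φ-kernel _ (offset-kernel w)) ⟩
    descend t (πᵛ w)                              ∎
    where open ≡-Reasoning

  descend-inverse : ∀ f g → RespectsFibres g → (∀ w → g (f w) ≡ w) →
    ∀ v → descend g (descend f v) ≡ v
  descend-inverse f g g-fibres g∘f≡id v = begin
    descend g (πᵛ (f (σᵛ v)))   ≡⟨ g-fibres (f (σᵛ v)) ⟨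
    πᵛ (g (f (σᵛ v)))           ≡⟨ cong πᵛ (g∘f≡id _) ⟩
    πᵛ (σᵛ v)                   ≡⟨ πᵛ-σᵛ v ⟩
    v                           ∎
    where open ≡-Reasoning

  module Descent (kernel-characteristic : KernelIsCharacteristic G Q π)
    (n : Perm G) (n∈N : InNormalizer G n) where
    open NormalizerAutomorphism G n n∈N
    open Inverse n using (to; from; strictlyInverseˡ; strictlyInverseʳ)

    conj-kernel : ∀ k → π k ≡ Q.ε → π (conj k) ≡ Q.ε
    conj-kernel k = Equivalence.from (kernel-characteristic conjugation conjugation-isAutomorphism k)

    conj⁻¹-kernel : ∀ k → π k ≡ Q.ε → π (conj⁻¹ k) ≡ Q.ε
    conj⁻¹-kernel k πk≡ε = Equivalence.to
      (kernel-characteristic conjugation conjugation-isAutomorphism (conj⁻¹ k))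
      (trans (cong π (conj-conj⁻¹ k)) πk≡ε)

    to-respectsFibres : RespectsFibres to
    to-respectsFibres = equivariant⇒respectsFibres conj conj-kernel conj-R

    from-respectsFibres : RespectsFibres from
    from-respectsFibres = equivariant⇒respectsFibres conj⁻¹ conj⁻¹-kernel conj⁻¹-R

    descendPerm : Perm Q
    descendPerm = mk↔ₛ′ (descend to) (descend from)
      (descend-inverse from to to-respectsFibres strictlyInverseˡ)
      (descend-inverse to from from-respectsFibres strictlyInverseʳ)

    descend-conj : ∀ g v → descend to (R Q (π g) (descend from v)) ≡ R Q (π (conj g)) v
    descend-conj g v = begin
      descend to (R Q (π g) (πᵛ u))       ≡⟨ cong (descend to) (πᵛ-R g u) ⟨
      descend to (πᵛ (R G g u))           ≡⟨ to-respectsFibres (R G g u) ⟨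
      πᵛ (to (R G g u))                   ≡⟨ cong πᵛ (conj-R g u) ⟩
      πᵛ (R G (conj g) (to u))            ≡⟨ πᵛ-R (conj g) (to u) ⟩
      R Q (π (conj g)) (πᵛ (to u))        ≡⟨ cong (R Q (π (conj g)) ∘ πᵛ) (strictlyInverseˡ _) ⟩
      R Q (π (conj g)) (πᵛ (σᵛ v))        ≡⟨ cong (R Q (π (conj g))) (πᵛ-σᵛ v) ⟩
      R Q (π (conj g)) v                  ∎
      where
      open ≡-Reasoning
      u = from (σᵛ v)

    descendPerm-normalizer : InNormalizer Q descendPerm
    descendPerm-normalizer =
      (λ q → π (conj (section q)) , λ v →
        subst (λ p → descend to (R Q p (descend from v)) ≡ R Q (π (conj (section q))) v)
              (π-section q) (descend-conj (section q) v)) ,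
      (λ q → π (conj⁻¹ (section q)) , λ v →
        trans (descend-conj (conj⁻¹ (section q)) v)
              (cong (λ p → R Q p v) (trans (cong π (conj-conj⁻¹ _)) (π-section q))))

    descendPerm-image : ∀ A B → ImageEquals G n (BCay G (A ∘ π)) (BCay G (B ∘ π)) →
      ImageEquals Q descendPerm (BCay Q A) (BCay Q B)
    descendPerm-image A B n-image a b = begin
      BCay Q A (πᵛ (from (σᵛ a))) (πᵛ (from (σᵛ b)))   ≈⟨ BCay-pullback A _ _ ⟨
      BCay G (A ∘ π) (from (σᵛ a)) (from (σᵛ b))       ≈⟨ n-image (σᵛ a) (σᵛ b) ⟩
      BCay G (B ∘ π) (σᵛ a) (σᵛ b)                     ≈⟨ BCay-pullback B _ _ ⟩
      BCay Q B (πᵛ (σᵛ a)) (πᵛ (σᵛ b))                 ≡⟨ cong₂ (BCay Q B) (πᵛ-σᵛ a) (πᵛ-σᵛ b) ⟩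
      BCay Q B a b                                     ∎
      where open import Relation.Binary.Reasoning.Setoid (⇔-setoid 0ℓ)

  2PCI-descends : KernelIsCharacteristic G Q π → Is2PCIGroup G → Is2PCIGroup Q
  2PCI-descends kernel-characteristic G-2PCI A B f f-iso f-bipartite
    with G-2PCI (A ∘ π) (B ∘ π) (liftPerm f) (liftPerm-isomorphism {f} A B f-iso)
                (liftPerm-preservesBipartition {f} f-bipartite)
  ... | n , n∈N , n-image = descendPerm , descendPerm-normalizer , descendPerm-image A B n-image
    where open Descent kernel-characteristic n n∈N

characteristic⇒kernelIsCharacteristic : ∀ (G Q : FinGroup) {π H} → KernelIs G Q π H →
  IsCharacteristic G H → KernelIsCharacteristic G Q π
characteristic⇒kernelIsCharacteristic G Q {π} {H} ker H-char α α-aut x = begin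
  π (Inverse.to α x) ≡ FinGroup.ε Q   ≈⟨ ker (Inverse.to α x) ⟩
  H (Inverse.to α x) ≡ true           ≡⟨ cong (_≡ true) (H-char α α-aut x) ⟩
  H x ≡ true                          ≈⟨ ker x ⟨
  π x ≡ FinGroup.ε Q                  ∎
  where open import Relation.Binary.Reasoning.Setoid (⇔-setoid 0ℓ)

-- H ⊆ G is a subgroup already as the kernel of π.
lemma3p9 : (G : FinGroup) → Is2PCIGroup G →
    (H : SubsetOf (Elt G)) → IsSubgroup G H → IsCharacteristic G H →
    (Q : FinGroup) (π : Elt G → Elt Q) → IsQuotientBy G Q H π →
    Is2PCIGroup Q
lemma3p9 G G-2PCI H _ H-char Q π (hom , sur , ker) =
  QuotientMap.2PCI-descends G Q π hom sur
    (characteristic⇒kernelIsCharacteristic G Q ker H-char) G-2PCI
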